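{- $GR(4, K_4, 3) = 10$.
   Context: For positive integers $r, s, t$, $GR(r, K_s, t)$ denotes the minimum number of vertices $n$ such that every edge-coloring of $K_n$ with $r$ colors contains a copy of $K_s$ whose edges use at most $t$ distinct colors. -}

module Defs where

open import Data.Nat using (ℕ; _≤_; _<_)
open import Data.Fin using (Fin)
open import Data.Fin.Subset using (Subset; _∈_; ∣_∣)
open import Data.Product using (Σ; _×_; ∃-syntax)
open import Relation.Binary.PropositionalEquality using (_≡_; _≢_)
open import Relation.Nullary using (¬_)
open import Function.Definitions using (Injective)

-- An edge-coloring of the complete graph K_n with r colors:
-- a color for each ordered pair, required symmetric (values on the diagonal are irrelevant).
record EdgeColoring (n r : ℕ) : Set where
  field
    colour    : Fin n → Fin n → Fin r
    symmetric : ∀ i j → colour i j ≡ colour j i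
open EdgeColoring public

HasFewColouredKs : ∀ {n r} → EdgeColoring n r → ℕ → ℕ → Set
HasFewColouredKs {n} {r} c s t =
  Σ (Fin s → Fin n) λ f → Injective _≡_ _≡_ f ×
    (∃[ S ] (∣ S ∣ ≤ t × (∀ (i j : Fin s) → i ≢ j → colour c (f i) (f j) ∈ S)))

GRProperty : ℕ → ℕ → ℕ → ℕ → Set
GRProperty r s t n = (c : EdgeColoring n r) → HasFewColouredKs c s t

GR≡ : ℕ → ℕ → ℕ → ℕ → Set
GR≡ r s t m = GRProperty r s t m × (∀ n → n < m → ¬ GRProperty r s t n)

-- Suppose every K₄ of a 4-coloured K₁₀ sees all four colours; fix a vertex v,
-- a colour i, and let W be the vertices joined to v in a colour other than i.  For u ∈ W, two
-- vertices of W that are not i-joined to u must be i-joined to each other (else {v,u,x,y}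
-- misses i), so there are at most three of them: an i-coloured K₄ misses the other colours.
-- Three vertices of W i-joined to u would be pairwise not i-joined (a K₄ with four i-edges
-- has at most three colours), and then {v,x,y,z} misses i; so there are at most two.  Hence
-- |W| ≤ 6: each colour occurs on at least three of the nine edges at v, which is absurd.
--
-- Identify the vertices of K₉ with the affine plane 𝔽₃² and colour the edge pq
-- by the direction of the line pq.  Each colour class is three disjoint triangles, so by
-- pigeonhole any four vertices contain two on a common line of each direction.

module Submission where

open import Defs
open import Algebra.Properties.CommutativeMonoid.Sum as Sum using ()
open import Data.Bool using (true; false; if_then_else_)
open import Data.Empty using (⊥-elim)
open import Data.Fin using (Fin; zero; suc; inject≤; toℕ)
open import Data.Fin.Properties
  using (_≟_; any?; all?; ¬∀⟶∃¬; pigeonhole; injective⇒≤; inject≤-injective)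
  renaming (<⇒≢ to <ᶠ⇒≢)
open import Data.Fin.Subset using (Subset; ⊤; ∁; ⁅_⁆; ∣_∣; _⊆_; _∉_)
  renaming (_∈_ to _∈ₛ_)
open import Data.Fin.Subset.Properties
  using (_∈?_; ∣⊤∣≡n; p⊆q⇒∣p∣≤∣q∣; ∣∁p∣≡n∸∣p∣; ∣⁅x⁆∣≡1; x∉p⇒x∈∁p; x≢y⇒x∉⁅y⁆)
open import Data.List using (List; []; _∷_; length; filter; lookup; tabulate)
open import Data.List.Membership.Propositional.Properties using (∈-lookup)
open import Data.List.Relation.Unary.All as All using (All; []; _∷_)
open import Data.List.Relation.Unary.All.Properties using (all-filter)
  renaming (filter⁺ to All-filter⁺)
open import Data.List.Relation.Unary.AllPairs using (AllPairs; []; _∷_; allPairs?)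
open import Data.List.Relation.Unary.Unique.Propositional using (Unique)
open import Data.List.Relation.Unary.Unique.Propositional.Properties using (allFin⁺)
  renaming (filter⁺ to Unique-filter⁺)
open import Data.Nat using (ℕ; zero; suc; _+_; _*_; _∸_; _≤_; _<_; z≤n; s≤s; _≤?_; _%_; _/_)
open import Data.Nat.DivMod using (_mod_)
open import Data.Nat.Properties
  using (≤-refl; ≤-reflexive; ≤-pred; ≤-<-trans; <⇒≱; +-suc; +-comm; +-mono-≤; +-monoʳ-≤;
         +-cancelˡ-≤; +-0-commutativeMonoid; module ≤-Reasoning)
open import Data.Product as Product using (∃-syntax; _,_; proj₁; proj₂; _×_)
open import Function using (_∘_)
open import Function.Definitions using (Injective)
open import Level using (Level; 0ℓ)
open import Relation.Binary using (Rel; Symmetric)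
open import Relation.Binary.PropositionalEquality
  using (_≡_; _≢_; refl; sym; trans; cong; cong₂; subst; ≢-sym; module ≡-Reasoning)
open import Relation.Nullary using (¬_; Dec; yes; no; does; ¬?; contradiction)
open import Relation.Nullary.Decidable using (_×-dec_; _→-dec_; decidable-stable; from-yes; from-no)
open import Relation.Unary using (Pred; Decidable)
open import Relation.Unary.Properties using (∁?)

open Sum +-0-commutativeMonoid using (sum-syntax; sum-cong-≗; ∑-distrib-+; sum-replicate-zero)

private
  variable
    a ℓ : Level
    A : Set a
    m n r s t : ℕ

<⇒∃∉image : m < n → (f : Fin m → Fin n) → ∃[ k ] (∀ j → f j ≢ k)
<⇒∃∉image m<n f with any? (λ k → all? (λ j → ¬? (f j ≟ k)))
... | yes missed = missed
... | no ¬missed = contradiction (injective⇒≤ preimage-injective) (<⇒≱ m<n)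
  where
  preimage : ∀ k → ∃[ j ] f j ≡ k
  preimage k = Product.map₂ (λ {j} → decidable-stable (f j ≟ k))
                 (¬∀⟶∃¬ _ _ (λ j → ¬? (f j ≟ k)) (¬missed ∘ (k ,_)))
  preimage-injective : Injective _≡_ _≡_ (proj₁ ∘ preimage)
  preimage-injective {k} {l} eq =
    trans (sym (proj₂ (preimage k))) (trans (cong f eq) (proj₂ (preimage l)))

∣p∣<n⇒∃∉p : (p : Subset n) → ∣ p ∣ < n → ∃[ x ] x ∉ p
∣p∣<n⇒∃∉p {n} p ∣p∣<n with any? (λ x → ¬? (x ∈? p))
... | yes outside = outside
... | no ¬outside = contradiction (subst (_≤ ∣ p ∣) (∣⊤∣≡n n) (p⊆q⇒∣p∣≤∣q∣ ⊤⊆p)) (<⇒≱ ∣p∣<n)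
  where
  ⊤⊆p : ⊤ ⊆ p
  ⊤⊆p {x} _ = decidable-stable (x ∈? p) (¬outside ∘ (x ,_))

module _ {P : Pred A ℓ} (P? : Decidable P) where

  length-filter-∷ : ∀ x xs →
    length (filter P? (x ∷ xs)) ≡ (if does (P? x) then 1 else 0) + length (filter P? xs)
  length-filter-∷ x xs with does (P? x)
  ... | true  = refl
  ... | false = refl

  length-filter+length-filter-∁ : ∀ xs →
    length (filter P? xs) + length (filter (∁? P?) xs) ≡ length xs
  length-filter+length-filter-∁ []       = refl
  length-filter+length-filter-∁ (x ∷ xs) with does (P? x)
  ... | true  = cong suc (length-filter+length-filter-∁ xs)
  ... | false = trans (+-suc _ _) (cong suc (length-filter+length-filter-∁ xs))

∑-indicator : (j : Fin r) → ∑[ i < r ] (if does (j ≟ i) then 1 else 0) ≡ 1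
∑-indicator {suc r} zero    = cong suc (sum-replicate-zero r)
∑-indicator {suc r} (suc j) = ∑-indicator j

∑-fibres : (g : A → Fin r) (xs : List A) →
           ∑[ i < r ] length (filter (λ x → g x ≟ i) xs) ≡ length xs
∑-fibres {r = r} g []       = sum-replicate-zero r
∑-fibres {r = r} g (x ∷ xs) = begin
  ∑[ i < r ] length (filter (λ y → g y ≟ i) (x ∷ xs)) ≡⟨ sum-cong-≗ (λ i → length-filter-∷ (λ y → g y ≟ i) x xs) ⟩
  ∑[ i < r ] (δ i + fibre i)                          ≡⟨ ∑-distrib-+ δ fibre ⟩
  ∑[ i < r ] δ i + ∑[ i < r ] fibre i                 ≡⟨ cong₂ _+_ (∑-indicator (g x)) (∑-fibres g xs) ⟩
  suc (length xs)                                     ∎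
  where
  open ≡-Reasoning
  δ fibre : Fin r → ℕ
  δ i     = if does (g x ≟ i) then 1 else 0
  fibre i = length (filter (λ y → g y ≟ i) xs)

∑-lowerBound : {f : Fin r → ℕ} → (∀ i → m ≤ f i) → r * m ≤ ∑[ i < r ] f i
∑-lowerBound {zero}  m≤f = z≤n
∑-lowerBound {suc r} m≤f = +-mono-≤ (m≤f zero) (∑-lowerBound (m≤f ∘ suc))

module _ {R : Rel A ℓ} where

  allPairs₄ : ∀ {x y z w} → R x y → R x z → R x w → R y z → R y w → R z w →
              AllPairs R (x ∷ y ∷ z ∷ w ∷ [])
  allPairs₄ xy xz xw yz yw zw = (xy ∷ xz ∷ xw ∷ []) ∷ (yz ∷ yw ∷ []) ∷ (zw ∷ []) ∷ [] ∷ []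

  lookup-AllPairs : Symmetric R → ∀ {xs} → AllPairs R xs →
                    ∀ {i j} → i ≢ j → R (lookup xs i) (lookup xs j)
  lookup-AllPairs R-sym (Rx ∷ _)   {zero}  {zero}  i≢j = contradiction refl i≢j
  lookup-AllPairs R-sym (Rx ∷ _)   {zero}  {suc j} _   = All.lookup Rx (∈-lookup j)
  lookup-AllPairs R-sym (Rx ∷ _)   {suc i} {zero}  _   = R-sym (All.lookup Rx (∈-lookup i))
  lookup-AllPairs R-sym (_  ∷ Rxs) {suc i} {suc j} i≢j = lookup-AllPairs R-sym Rxs (i≢j ∘ cong suc)

restrict : n ≤ m → EdgeColoring m r → EdgeColoring n r
restrict n≤m c = record
  { colour    = λ i j → colour c (inject≤ i n≤m) (inject≤ j n≤m)
  ; symmetric = λ i j → symmetric c (inject≤ i n≤m) (inject≤ j n≤m)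
  }

GRProperty-mono : n ≤ m → GRProperty r s t n → GRProperty r s t m
GRProperty-mono n≤m P c with f , f-injective , S , ∣S∣≤t , edgesInS ← P (restrict n≤m c) =
  (λ i → inject≤ (f i) n≤m) , f-injective ∘ inject≤-injective _ _ _ _ , S , ∣S∣≤t , edgesInS

AvoidsColour : EdgeColoring n r → Fin r → List (Fin n) → Set
AvoidsColour c k = AllPairs (λ x y → colour c x y ≢ k)

avoidsColour⇒fewColoured : (c : EdgeColoring n (suc t)) {k : Fin (suc t)} {xs : List (Fin n)} →
                           Unique xs → AvoidsColour c k xs → HasFewColouredKs c (length xs) t
avoidsColour⇒fewColoured {t = t} c {k} {xs} distinct avoids =
  lookup xs , lookup-injective , ∁ ⁅ k ⁆ , ∣∁⁅k⁆∣≤t ,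
  λ i j i≢j → x∉p⇒x∈∁p (x≢y⇒x∉⁅y⁆ (lookup-AllPairs avoids-sym avoids i≢j))
  where
  lookup-injective : Injective _≡_ _≡_ (lookup xs)
  lookup-injective {i} {j} eq =
    decidable-stable (i ≟ j) (λ i≢j → lookup-AllPairs ≢-sym distinct i≢j eq)
  avoids-sym : Symmetric (λ x y → colour c x y ≢ k)
  avoids-sym {x} {y} xy≢k = xy≢k ∘ trans (symmetric c x y)
  ∣∁⁅k⁆∣≤t : ∣ ∁ ⁅ k ⁆ ∣ ≤ t
  ∣∁⁅k⁆∣≤t = ≤-reflexive (trans (∣∁p∣≡n∸∣p∣ ⁅ k ⁆) (cong (suc t ∸_) (∣⁅x⁆∣≡1 k)))

cliquePartitions⇒¬fewColoured : (c : EdgeColoring n r) (part : Fin r → Fin n → Fin m) →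
  (∀ k x y → x ≢ y → part k x ≡ part k y → colour c x y ≡ k) →
  t < r → ¬ HasFewColouredKs c (suc m) t
cliquePartitions⇒¬fewColoured c part sameColour t<r (f , f-injective , S , ∣S∣≤t , edgesInS)
  with k , k∉S ← ∣p∣<n⇒∃∉p S (≤-<-trans ∣S∣≤t t<r)
  with i , j , i<j , samePart ← pigeonhole ≤-refl (part k ∘ f)
  = k∉S (subst (_∈ₛ S) (sameColour k _ _ (<ᶠ⇒≢ i<j ∘ f-injective) samePart)
                       (edgesInS i j (<ᶠ⇒≢ i<j)))

-- Vertex p is the point (p / 3, p % 3) of 𝔽₃², and 2 * a stands for -a.  The edge pq has colour 0
-- if the line pq is vertical and colour 1 + slope otherwise, the slope being dy * dx as dx⁻¹ = dx
-- in 𝔽₃.  The lines of direction k are indexed by x, resp. by the intercept y - slope * x.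
module AffinePlane where

  xCoord yCoord : Fin 9 → ℕ
  xCoord p = toℕ p / 3
  yCoord p = toℕ p % 3

  direction : ℕ → ℕ → Fin 4
  direction zero      dy = zero
  direction dx@(suc _) dy = suc ((dy * dx) mod 3)

  colour₉ : Fin 9 → Fin 9 → Fin 4
  colour₉ p q = direction ((xCoord p + 2 * xCoord q) % 3) ((yCoord p + 2 * yCoord q) % 3)

  line : Fin 4 → Fin 9 → Fin 3
  line zero    p = xCoord p mod 3
  line (suc s) p = (yCoord p + 2 * toℕ s * xCoord p) mod 3

  colouring : EdgeColoring 9 4
  colouring = record
    { colour    = colour₉
    ; symmetric = from-yes (all? λ p → all? λ q → colour₉ p q ≟ colour₉ q p)
    }

  lines-monochromatic : ∀ k p q → p ≢ q → line k p ≡ line k q → colour₉ p q ≡ k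
  lines-monochromatic = from-yes (all? λ k → all? λ p → all? λ q →
    ¬? (p ≟ q) →-dec line k p ≟ line k q →-dec colour₉ p q ≟ k)

  noFewColouredK4 : ¬ HasFewColouredKs colouring 4 3
  noFewColouredK4 = cliquePartitions⇒¬fewColoured colouring line lines-monochromatic ≤-refl

K4AvoidingColour : EdgeColoring n r → Set
K4AvoidingColour c = ∃[ a ] ∃[ b ] ∃[ d ] ∃[ e ] ∃[ k ]
  (Unique (a ∷ b ∷ d ∷ e ∷ []) × AvoidsColour c k (a ∷ b ∷ d ∷ e ∷ []))

K4AvoidingColour? : (c : EdgeColoring n r) → Dec (K4AvoidingColour c)
K4AvoidingColour? c = any? λ a → any? λ b → any? λ d → any? λ e → any? λ k →
  allPairs? (λ x y → ¬? (x ≟ y)) _ ×-dec allPairs? (λ x y → ¬? (colour c x y ≟ k)) _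

K4AvoidingColour⇒fewColoured : (c : EdgeColoring n (suc t)) → K4AvoidingColour c → HasFewColouredKs c 4 t
K4AvoidingColour⇒fewColoured c (_ , _ , _ , _ , _ , distinct , avoids) = avoidsColour⇒fewColoured c distinct avoids

module EveryK4SeesEveryColour (c : EdgeColoring n 4) (seesAll : ¬ K4AvoidingColour c) where

  private
    variable
      u v w x y z : Fin n
      i : Fin 4
      ws : List (Fin n)

  sixthEdgeForced : Unique (u ∷ v ∷ x ∷ y ∷ []) →
                    colour c u v ≢ i → colour c u x ≢ i → colour c u y ≢ i →
                    colour c v x ≢ i → colour c v y ≢ i → colour c x y ≡ i
  sixthEdgeForced {x = x} {y} {i} distinct uv ux uy vx vy =
    decidable-stable (colour c x y ≟ i) λ xy →
      seesAll (_ , _ , _ , _ , _ , distinct , allPairs₄ uv ux uy vx vy xy)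

  leavesOfMonochromaticClaw : Unique (u ∷ x ∷ y ∷ z ∷ []) →
                              colour c u x ≡ i → colour c u y ≡ i → colour c u z ≡ i →
                              colour c x y ≢ i
  leavesOfMonochromaticClaw {x = x} {y} {z} {i} distinct ux uy uz xy
    with k , missed ← <⇒∃∉image ≤-refl
                        (λ { zero → i ; (suc zero) → colour c x z ; (suc (suc zero)) → colour c y z })
    = seesAll (_ , _ , _ , _ , k , distinct ,
               allPairs₄ (≢k ux) (≢k uy) (≢k uz) (≢k xy) (missed (suc zero)) (missed (suc (suc zero))))
    where
    ≢k : ∀ {j} → j ≡ i → j ≢ k
    ≢k refl = missed zero

  nonNeighbours⇒clique : Unique (v ∷ u ∷ ws) → All (λ w → colour c v w ≢ i) (u ∷ ws) →
                         All (λ w → colour c u w ≢ i) ws → AllPairs (λ x y → colour c x y ≡ i) ws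
  nonNeighbours⇒clique _ _ [] = []
  nonNeighbours⇒clique ((vu ∷ vx ∷ vys) ∷ (ux ∷ uys) ∷ (xys ∷ ys!)) (cvu ∷ cvx ∷ cvys) (cux ∷ cuys) =
    All.tabulate (λ y∈ →
      sixthEdgeForced (allPairs₄ vu vx (All.lookup vys y∈) ux (All.lookup uys y∈) (All.lookup xys y∈))
                      cvu cvx (All.lookup cvys y∈) cux (All.lookup cuys y∈))
    ∷ nonNeighbours⇒clique ((vu ∷ vys) ∷ (uys ∷ ys!)) (cvu ∷ cvys) cuys

  monochromaticClique≤3 : Unique ws → AllPairs (λ x y → colour c x y ≡ i) ws → length ws ≤ 3
  monochromaticClique≤3 {[]}                  _ _ = z≤n
  monochromaticClique≤3 {_ ∷ []}              _ _ = s≤s z≤n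
  monochromaticClique≤3 {_ ∷ _ ∷ []}          _ _ = s≤s (s≤s z≤n)
  monochromaticClique≤3 {_ ∷ _ ∷ _ ∷ []}      _ _ = s≤s (s≤s (s≤s z≤n))
  monochromaticClique≤3 {_ ∷ _ ∷ _ ∷ _ ∷ _}
    ((xy ∷ xz ∷ xw ∷ _) ∷ (yz ∷ yw ∷ _) ∷ (zw ∷ _) ∷ _) ((cxy ∷ cxz ∷ cxw ∷ _) ∷ (cyz ∷ _) ∷ _) =
    contradiction cyz (leavesOfMonochromaticClaw (allPairs₄ xy xz xw yz yw zw) cxy cxz cxw)

  neighbours≤2 : Unique (v ∷ u ∷ ws) → All (λ w → colour c v w ≢ i) ws →
                 All (λ w → colour c u w ≡ i) ws → length ws ≤ 2
  neighbours≤2 {ws = []}              _ _ _ = z≤n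
  neighbours≤2 {ws = _ ∷ []}          _ _ _ = s≤s z≤n
  neighbours≤2 {ws = _ ∷ _ ∷ []}      _ _ _ = s≤s (s≤s z≤n)
  neighbours≤2 {ws = x ∷ y ∷ z ∷ _} {i = i}
    ((_ ∷ vx ∷ vy ∷ vz ∷ _) ∷ (ux ∷ uy ∷ uz ∷ _) ∷ (xy ∷ xz ∷ _) ∷ (yz ∷ _) ∷ _)
    (cvx ∷ cvy ∷ cvz ∷ _) (cux ∷ cuy ∷ cuz ∷ _) =
    ⊥-elim (seesAll (_ , _ , _ , _ , _ , allPairs₄ vx vy vz xy xz yz , allPairs₄ cvx cvy cvz cxy cxz cyz))
    where
    cxy : colour c x y ≢ i
    cxz : colour c x z ≢ i
    cyz : colour c y z ≢ i
    cxy = leavesOfMonochromaticClaw (allPairs₄ ux uy uz xy xz yz) cux cuy cuz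
    cxz = leavesOfMonochromaticClaw (allPairs₄ ux uz uy xz xy (≢-sym yz)) cux cuz cuy
    cyz = leavesOfMonochromaticClaw (allPairs₄ uy uz ux yz (≢-sym xy) (≢-sym xz)) cuy cuz cux

  otherColours≤6 : Unique (v ∷ ws) → All (λ w → colour c v w ≢ i) ws → length ws ≤ 6
  otherColours≤6 {ws = []} _ _ = z≤n
  otherColours≤6 {v} {u ∷ ws} {i} ((vu ∷ vws) ∷ uws ∷ ws!) (cvu ∷ cvws) = begin
    suc (length ws)                                                ≡⟨ cong suc (length-filter+length-filter-∁ joined? ws) ⟨
    suc (length (filter joined? ws) + length (filter notJoined? ws)) ≤⟨ s≤s (+-mono-≤ neighbours nonNeighbours) ⟩
    6                                                              ∎
    where
    open ≤-Reasoning
    joined? : Decidable (λ w → colour c u w ≡ i)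
    joined? w = colour c u w ≟ i
    notJoined? : Decidable (λ w → colour c u w ≢ i)
    notJoined? = ∁? joined?
    filtered : {P : Pred (Fin n) 0ℓ} (P? : Decidable P) → Unique (v ∷ u ∷ filter P? ws)
    filtered P? = (vu ∷ All-filter⁺ P? vws) ∷ All-filter⁺ P? uws ∷ Unique-filter⁺ P? ws!
    neighbours : length (filter joined? ws) ≤ 2
    neighbours = neighbours≤2 (filtered joined?) (All-filter⁺ joined? cvws) (all-filter joined? ws)
    nonNeighbours : length (filter notJoined? ws) ≤ 3
    nonNeighbours = monochromaticClique≤3 (Unique-filter⁺ notJoined? ws!)
      (nonNeighbours⇒clique (filtered notJoined?) (cvu ∷ All-filter⁺ notJoined? cvws) (all-filter notJoined? ws))

  length≤6+colourDegree : Unique (v ∷ ws) → length ws ≤ 6 + length (filter (λ w → colour c v w ≟ i) ws)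
  length≤6+colourDegree {v} {ws} {i} (vws ∷ ws!) = begin
    length ws                                           ≡⟨ length-filter+length-filter-∁ inColour? ws ⟨
    length (filter inColour? ws) + length (filter (∁? inColour?) ws) ≤⟨ +-monoʳ-≤ _ otherColours ⟩
    length (filter inColour? ws) + 6                    ≡⟨ +-comm _ 6 ⟩
    6 + length (filter inColour? ws)                    ∎
    where
    open ≤-Reasoning
    inColour? : Decidable (λ w → colour c v w ≡ i)
    inColour? w = colour c v w ≟ i
    otherColours : length (filter (∁? inColour?) ws) ≤ 6
    otherColours = otherColours≤6 (All-filter⁺ (∁? inColour?) vws ∷ Unique-filter⁺ (∁? inColour?) ws!)
                                  (all-filter (∁? inColour?) ws)

tenVertices⇒K4AvoidingColour : (c : EdgeColoring 10 4) → ¬ ¬ K4AvoidingColour c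
tenVertices⇒K4AvoidingColour c seesAll = from-no (12 ≤? 9) (begin
  4 * 3                                   ≤⟨ ∑-lowerBound (λ i → +-cancelˡ-≤ 6 3 _ (colourDegree i)) ⟩
  ∑[ i < 4 ] length (filter (inColour i) ws) ≡⟨ ∑-fibres (colour c zero) ws ⟩
  9                                       ∎)
  where
  open EveryK4SeesEveryColour c seesAll
  open ≤-Reasoning
  ws : List (Fin 10)
  ws = tabulate {n = 9} suc
  inColour : (i : Fin 4) → Decidable (λ w → colour c zero w ≡ i)
  inColour i w = colour c zero w ≟ i
  colourDegree : ∀ i → 9 ≤ 6 + length (filter (inColour i) ws)
  colourDegree i = length≤6+colourDegree {ws = ws} {i = i} (allFin⁺ 10)   -- allFin 10 = zero ∷ ws

upperBound : GRProperty 4 4 3 10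
upperBound c =
  K4AvoidingColour⇒fewColoured c (decidable-stable (K4AvoidingColour? c) (tenVertices⇒K4AvoidingColour c))

lowerBound : ∀ n → n < 10 → ¬ GRProperty 4 4 3 n
lowerBound n n<10 P =
  AffinePlane.noFewColouredK4 (GRProperty-mono (≤-pred n<10) P AffinePlane.colouring)

mainTheorem13 : GR≡ 4 4 3 10
mainTheorem13 = upperBound , lowerBound
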